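{- If $G$ is a cubic graph (a finite simple graph in which every vertex has degree $3$), then $C_3(G)=4$ if $G$ is bipartite, and $C_3(G)=3$ otherwise.
   Context: A set $S\subseteq V(G)$ is a $3$-dominating set of $G$ if every vertex $v\in V(G)\setminus S$ has at least $3$ neighbors in $S$. Two disjoint sets $A,B\subseteq V(G)$ form a $3$-coalition if neither $A$ nor $B$ is a $3$-dominating set of $G$ but $A\cup B$ is a $3$-dominating set of $G$. A $3$-coalition partition of $G$ is a partition $\Theta$ of $V(G)$ such that every set in $\Theta$ is either a $3$-dominating set of cardinality $3$ or forms a $3$-coalition with another set of $\Theta$. $C_3(G)$ is the maximum cardinality of a $3$-coalition partition of $G$. -}

module Defs where

open import Data.Nat using (ℕ; zero; suc; _+_; _≤_)
open import Data.Fin using (Fin; zero; suc; _≟_)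
open import Data.Bool using (Bool; true; false; _∨_; if_then_else_)
open import Data.Product using (Σ; ∃; ∃-syntax; _×_; _,_)
open import Data.Sum using (_⊎_)
open import Relation.Nullary using (¬_; does)
open import Relation.Binary.PropositionalEquality using (_≡_; _≢_)

record Graph (n : ℕ) : Set where
  field
    adj   : Fin n → Fin n → Bool
    sym   : ∀ u v → adj u v ≡ adj v u
    irref : ∀ v → adj v v ≡ false
open Graph public

card : ∀ {n} → (Fin n → Bool) → ℕ
card {zero}  P = 0
card {suc n} P = (if P zero then 1 else 0) + card (λ i → P (suc i))

VSet : ℕ → Set
VSet n = Fin n → Bool

_∪_ : ∀ {n} → VSet n → VSet n → VSet n
(A ∪ B) v = A v ∨ B v

degree : ∀ {n} → Graph n → Fin n → ℕ
degree G v = card (adj G v)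

Cubic : ∀ {n} → Graph n → Set
Cubic G = ∀ v → degree G v ≡ 3

Bipartite : ∀ {n} → Graph n → Set
Bipartite {n} G = Σ (Fin n → Bool) λ c → ∀ u v → adj G u v ≡ true → c u ≢ c v

nbrsIn : ∀ {n} → Graph n → VSet n → Fin n → ℕ
nbrsIn G S v = card (λ u → if adj G v u then S u else false)

ThreeDom : ∀ {n} → Graph n → VSet n → Set
ThreeDom G S = ∀ v → S v ≡ false → 3 ≤ nbrsIn G S v

ThreeCoalition : ∀ {n} → Graph n → VSet n → VSet n → Set
ThreeCoalition G A B = ¬ ThreeDom G A × ¬ ThreeDom G B × ThreeDom G (A ∪ B)

-- A partition of V(G) into exactly k (nonempty) parts is given by a
-- surjective class map; part i = { v | cls v = i }.
part : ∀ {n k} → (Fin n → Fin k) → Fin k → VSet n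
part cls i v = does (cls v ≟ i)

IsThreeCoalitionPartition : ∀ {n} → Graph n → (k : ℕ) → (Fin n → Fin k) → Set
IsThreeCoalitionPartition {n} G k cls =
  (∀ i → ∃[ v ] cls v ≡ i) ×
  (∀ i → (ThreeDom G (part cls i) × card (part cls i) ≡ 3)
         ⊎ (∃[ j ] (j ≢ i × ThreeCoalition G (part cls i) (part cls j))))

HasThreeCoalitionPartition : ∀ {n} → Graph n → ℕ → Set
HasThreeCoalitionPartition {n} G k =
  Σ (Fin n → Fin k) λ cls → IsThreeCoalitionPartition G k cls

C₃≡ : ∀ {n} → Graph n → ℕ → Set
C₃≡ G m = HasThreeCoalitionPartition G m × (∀ k → HasThreeCoalitionPartition G k → k ≤ m)

module Submission where

-- In a cubic graph a vertex outside S has three neighbours in S exactly when all its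
-- neighbours lie in S, so the 3-dominating sets are the vertex covers. Collapsing the
-- classes of a 3-coalition partition gives a quotient graph (with loops, without isolated
-- vertices) in which every class covers all edges on its own or together with a partner,
-- while neither partner does alone. Following partners shows that either there are at most
-- three classes, or two disjoint pairs of classes are both vertex covers; then every class
-- lies in one of the pairs, and membership in the first pair properly 2-colours the quotient,
-- hence G. Conversely, for a walk y v u x without backtracking, the classes {v}, {u} and the
-- rest form a 3-coalition partition, and if G is bipartite, splitting the rest by colour
-- gives one with four classes.

open import Defs hiding (sym)
open import Data.Bool using (Bool; true; false; not; if_then_else_)
open import Data.Bool.Properties using (¬-not; not-involutive) renaming (_≟_ to _≟ᵇ_)
open import Data.Empty using (⊥-elim)
open import Data.Fin using (Fin; zero; suc; _≟_; _↑ʳ_; fromℕ<)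
open import Data.Fin.Properties using (any?; injective⇒≤)
open import Data.Fin.Subset using (∣_∣; ⁅_⁆) renaming (_∈_ to _∈ₛ_; _⊆_ to _⊆ₛ_)
open import Data.Fin.Subset.Properties
  using (p⊆q⇒∣p∣≤∣q∣; p⊂q⇒∣p∣<∣q∣; nonempty?; Empty-unique; ∣⊥∣≡0; ∣⁅x⁆∣≡1; x∈⁅y⁆⇔x≡y)
open import Data.List using (List; []; _∷_; [_]; _++_; length; lookup)
open import Data.List.Membership.Propositional using (_∈_)
open import Data.List.Membership.Propositional.Properties using (∈-++⁺ˡ; ∈-++⁺ʳ)
open import Data.List.Relation.Binary.Disjoint.Propositional using (Disjoint)
open import Data.List.Relation.Unary.All as All using (All; []; _∷_; all?)
open import Data.List.Relation.Unary.All.Properties using (¬Any⇒All¬; All¬⇒¬Any)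
open import Data.List.Relation.Unary.Any as Any using (here; there)
open import Data.List.Relation.Unary.Any.Properties using (lookup-index)
open import Data.Nat using (ℕ; zero; suc; _+_; _≤_; _<_; z≤n; s≤s)
open import Data.Nat.Properties using (≤-reflexive; ≤-trans; <⇒≱; n≤1+n; module ≤-Reasoning)
open import Data.Product as Product using (∃; ∃₂; ∃-syntax; _×_; _,_; proj₁)
open import Data.Sum as Sum using (_⊎_; inj₁; inj₂)
open import Data.Vec using (tabulate)
open import Data.Vec.Properties using ([]=⇒lookup; lookup⇒[]=; lookup∘tabulate)
open import Function using (_∘_; id; _⇔_; mk⇔; Equivalence)
import Function.Properties.Equivalence as ⇔
open import Relation.Nullary using (¬_; does; yes; no; contradiction)
open import Relation.Nullary.Decidable using (decidable-stable; dec-true; dec-false; ¬?; _×-dec_)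
open import Relation.Binary.PropositionalEquality
  using (_≡_; _≢_; refl; sym; trans; cong; subst; module ≡-Reasoning)

open Equivalence using (to; from)

private variable
  n k : ℕ
  A : Set
  P Q : Fin n → Bool

card≡∣tabulate∣ : (P : Fin n → Bool) → card P ≡ ∣ tabulate P ∣
card≡∣tabulate∣ {zero}  P = refl
card≡∣tabulate∣ {suc n} P with P zero
... | true  = cong suc (card≡∣tabulate∣ (P ∘ suc))
... | false = card≡∣tabulate∣ (P ∘ suc)

∈-tabulate : ∀ {x} → x ∈ₛ tabulate P ⇔ P x ≡ true
∈-tabulate {P = P} {x} = mk⇔
  (λ x∈P → trans (sym (lookup∘tabulate P x)) ([]=⇒lookup x∈P))
  (λ Px → lookup⇒[]= x (tabulate P) (trans (lookup∘tabulate P x) Px))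

tabulate-⊆ : (∀ x → P x ≡ true → Q x ≡ true) → tabulate P ⊆ₛ tabulate Q
tabulate-⊆ P⊆Q x∈P = from ∈-tabulate (P⊆Q _ (to ∈-tabulate x∈P))

card-mono : (∀ x → P x ≡ true → Q x ≡ true) → card P ≤ card Q
card-mono {P = P} {Q = Q} P⊆Q = begin
  card P          ≡⟨ card≡∣tabulate∣ P ⟩
  ∣ tabulate P ∣  ≤⟨ p⊆q⇒∣p∣≤∣q∣ (tabulate-⊆ P⊆Q) ⟩
  ∣ tabulate Q ∣  ≡⟨ sym (card≡∣tabulate∣ Q) ⟩
  card Q          ∎
  where open ≤-Reasoning

card-mono-< : ∀ {y} → (∀ x → P x ≡ true → Q x ≡ true) → P y ≡ false → Q y ≡ true → card P < card Q
card-mono-< {P = P} {Q = Q} {y} P⊆Q ¬Py Qy = begin-strict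
  card P          ≡⟨ card≡∣tabulate∣ P ⟩
  ∣ tabulate P ∣  <⟨ p⊂q⇒∣p∣<∣q∣ (tabulate-⊆ P⊆Q , y , from ∈-tabulate Qy , y∉P) ⟩
  ∣ tabulate Q ∣  ≡⟨ sym (card≡∣tabulate∣ Q) ⟩
  card Q          ∎
  where
    open ≤-Reasoning
    y∉P : ¬ y ∈ₛ tabulate P
    y∉P y∈P with () ← trans (sym ¬Py) (to ∈-tabulate y∈P)

card-pos⇒∃ : 0 < card P → ∃ λ x → P x ≡ true
card-pos⇒∃ {n} {P} pos with nonempty? (tabulate P)
... | yes (x , x∈P) = x , to ∈-tabulate x∈P
... | no empty      = contradiction (subst (0 <_) card≡0 pos) λ ()
  where
    card≡0 : card P ≡ 0
    card≡0 = trans (card≡∣tabulate∣ P) (trans (cong ∣_∣ (Empty-unique empty)) (∣⊥∣≡0 n))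

card-≤1 : ∀ {y} → (∀ x → P x ≡ true → x ≡ y) → card P ≤ 1
card-≤1 {P = P} {y} P⊆y = begin
  card P          ≡⟨ card≡∣tabulate∣ P ⟩
  ∣ tabulate P ∣  ≤⟨ p⊆q⇒∣p∣≤∣q∣ (from x∈⁅y⁆⇔x≡y ∘ P⊆y _ ∘ to ∈-tabulate) ⟩
  ∣ ⁅ y ⁆ ∣       ≡⟨ ∣⁅x⁆∣≡1 y ⟩
  1               ∎
  where open ≤-Reasoning

Covers : (A → A → Set) → (A → Set) → Set
Covers E P = ∀ {x y} → E x y → P x ⊎ P y

IsTwoColouring : (A → A → Set) → (A → Bool) → Set
IsTwoColouring E c = ∀ x y → E x y → c x ≢ c y

∈-pair-swap : ∀ {x a b : A} → x ∈ a ∷ b ∷ [] → x ∈ b ∷ a ∷ []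
∈-pair-swap (here x≡a)         = there (here x≡a)
∈-pair-swap (there (here x≡b)) = here x≡b

≡-≢-trans : ∀ {a b c : A} → a ≡ b → b ≢ c → a ≢ c
≡-≢-trans refl b≢c = b≢c

module _ {E : A → A → Set} where

  covers-mono : ∀ {P Q : A → Set} → (∀ {x} → P x → Q x) → Covers E P → Covers E Q
  covers-mono P⊆Q cover xy = Sum.map P⊆Q P⊆Q (cover xy)

  covers-swap : ∀ {a b} → Covers E (_∈ a ∷ b ∷ []) → Covers E (_∈ b ∷ a ∷ [])
  covers-swap = covers-mono ∈-pair-swap

  partner-≢ : ∀ {a b} → ¬ Covers E (_∈ [ a ]) → Covers E (_∈ a ∷ b ∷ []) → b ≢ a
  partner-≢ ¬a ab refl = ¬a (covers-mono collapse ab)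
    where
      collapse : ∀ {x a} → x ∈ a ∷ a ∷ [] → x ∈ [ a ]
      collapse (here x≡a)         = here x≡a
      collapse (there (here x≡a)) = here x≡a

  colour-class-covers : ∀ {c} → IsTwoColouring E c → ∀ b → Covers E (λ x → c x ≡ b)
  colour-class-covers {c} proper b {x} {y} xy with c x ≟ᵇ b
  ... | yes cx≡b = inj₁ cx≡b
  ... | no  cx≢b = inj₂ (begin
    c y          ≡⟨ ¬-not (proper x y xy ∘ sym) ⟩
    not (c x)    ≡⟨ cong not (¬-not cx≢b) ⟩
    not (not b)  ≡⟨ not-involutive b ⟩
    b            ∎)
    where open ≡-Reasoning

  colour-coclass-covers : ∀ {c} → IsTwoColouring E c → ∀ b → Covers E (λ x → c x ≢ b)
  colour-coclass-covers {c} proper b {x} {y} xy with c x ≟ᵇ b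
  ... | yes refl = inj₂ (proper x y xy ∘ sym)
  ... | no  cx≢b = inj₁ cx≢b

-- 3-domination in graphs of degree three

Adj : Graph n → Fin n → Fin n → Set
Adj G u v = adj G u v ≡ true

module _ (G : Graph n) where

  adj⇒≢ : ∀ {u v} → Adj G u v → u ≢ v
  adj⇒≢ {u} uv refl with () ← trans (sym uv) (irref G u)

  covers-≢ : ∀ w → Covers (Adj G) (_≢ w)
  covers-≢ w {u} uv with u ≟ w
  ... | no  u≢w  = inj₁ u≢w
  ... | yes refl = inj₂ (adj⇒≢ uv ∘ sym)

  private
    nbrsIn⊆nbrs : ∀ (S : VSet n) v w → (if adj G v w then S w else false) ≡ true → adj G v w ≡ true
    nbrsIn⊆nbrs S v w with adj G v w
    ... | true  = λ _ → refl
    ... | false = λ ()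

  nbrsIn<degree : ∀ {S v u} → Adj G v u → S u ≡ false → nbrsIn G S v < degree G v
  nbrsIn<degree {S} {v} {u} vu Su =
    card-mono-< (nbrsIn⊆nbrs S v) (subst (λ b → (if b then S u else false) ≡ false) (sym vu) Su) vu

  degree≤nbrsIn : ∀ {S v} → (∀ {w} → Adj G v w → S w ≡ true) → degree G v ≤ nbrsIn G S v
  degree≤nbrsIn {S} N⊆S =
    card-mono λ w vw → subst (λ b → (if b then S w else false) ≡ true) (sym vw) (N⊆S vw)

  edge-outside⇒¬threeDom : (∀ v → degree G v ≤ 3) → ∀ {S u v} → Adj G u v → S u ≡ false → S v ≡ false →
                           ¬ ThreeDom G S
  edge-outside⇒¬threeDom Δ≤3 {S} {u} uv Su Sv dom = <⇒≱ (begin-strict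
    nbrsIn G S u  <⟨ nbrsIn<degree uv Sv ⟩
    degree G u    ≤⟨ Δ≤3 u ⟩
    3             ∎) (dom u Su)
    where open ≤-Reasoning

  threeDom⇒covers : (∀ v → degree G v ≤ 3) → ∀ {S} → ThreeDom G S → Covers (Adj G) (λ v → S v ≡ true)
  threeDom⇒covers Δ≤3 {S} dom {u} {v} uv with S u in Su | S v in Sv
  ... | true  | _     = inj₁ refl
  ... | false | true  = inj₂ refl
  ... | false | false = contradiction dom (edge-outside⇒¬threeDom Δ≤3 uv Su Sv)

  covers⇒threeDom : (∀ v → 3 ≤ degree G v) → ∀ {S} → Covers (Adj G) (λ v → S v ≡ true) → ThreeDom G S
  covers⇒threeDom δ≥3 {S} cover v Sv = ≤-trans (δ≥3 v) (degree≤nbrsIn N⊆S)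
    where
      N⊆S : ∀ {w} → Adj G v w → S w ≡ true
      N⊆S vw with cover vw
      ... | inj₁ Sv≡true = contradiction (trans (sym Sv) Sv≡true) λ ()
      ... | inj₂ Sw≡true = Sw≡true

  threeDom⇔covers : Cubic G → ∀ {S P} → (∀ v → S v ≡ true ⇔ P v) → ThreeDom G S ⇔ Covers (Adj G) P
  threeDom⇔covers cubic S⇔P = mk⇔
    (covers-mono (λ {v} → to (S⇔P v)) ∘ threeDom⇒covers (≤-reflexive ∘ cubic))
    (covers⇒threeDom (≤-reflexive ∘ sym ∘ cubic) ∘ covers-mono (λ {v} → from (S⇔P v)))

  ∃-neighbour-≢ : ∀ {v} → 1 < degree G v → ∀ u → ∃ λ w → w ≢ u × Adj G v w
  ∃-neighbour-≢ {v} δ>1 u with any? (λ w → ¬? (w ≟ u) ×-dec (adj G v w ≟ᵇ true))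
  ... | yes found = found
  ... | no  none  = contradiction (card-≤1 N⊆u) (<⇒≱ δ>1)
    where
      N⊆u : ∀ w → adj G v w ≡ true → w ≡ u
      N⊆u w vw = decidable-stable (w ≟ u) λ w≢u → none (w , w≢u , vw)

-- The quotient graph of a partition

part-∈ : (cls : Fin n → Fin k) → ∀ {i v} → part cls i v ≡ true ⇔ cls v ∈ [ i ]
part-∈ cls {i} {v} with cls v ≟ i
... | yes cv≡i = mk⇔ (λ _ → here cv≡i) (λ _ → refl)
... | no  cv≢i = mk⇔ (λ ()) λ { (here cv≡i) → contradiction cv≡i cv≢i }

part∪-∈ : (cls : Fin n → Fin k) → ∀ {i j v} → (part cls i ∪ part cls j) v ≡ true ⇔ cls v ∈ i ∷ j ∷ []
part∪-∈ cls {i} {j} {v} with cls v ≟ i | cls v ≟ j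
... | yes cv≡i | _        = mk⇔ (λ _ → here cv≡i) (λ _ → refl)
... | no  _    | yes cv≡j = mk⇔ (λ _ → there (here cv≡j)) (λ _ → refl)
... | no  cv≢i | no  cv≢j = mk⇔ (λ ()) λ
  { (here cv≡i)         → contradiction cv≡i cv≢i
  ; (there (here cv≡j)) → contradiction cv≡j cv≢j
  }

Quotient : Graph n → (Fin n → Fin k) → Fin k → Fin k → Set
Quotient G cls X Y = ∃₂ λ u v → Adj G u v × cls u ≡ X × cls v ≡ Y

covers-quotient⇔ : ∀ (G : Graph n) (cls : Fin n → Fin k) {P} →
                   Covers (Quotient G cls) P ⇔ Covers (Adj G) (P ∘ cls)
covers-quotient⇔ G cls = mk⇔
  (λ cover {u} {v} uv → cover (u , v , uv , refl , refl))
  (λ { cover {_} {_} (_ , _ , uv , refl , refl) → cover uv })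

quotient-colouring⇒bipartite : (G : Graph n) (cls : Fin n → Fin k) →
                               ∃ (IsTwoColouring (Quotient G cls)) → Bipartite G
quotient-colouring⇒bipartite G cls (c , proper) =
  c ∘ cls , λ u v uv → proper _ _ (u , v , uv , refl , refl)

-- Graphs in which every vertex has a partner

-- The alternatives in the definition of a 3-coalition partition, read in the quotient graph.
Partnered : (Fin k → Fin k → Set) → Fin k → Set
Partnered E i = Covers E (_∈ [ i ])
              ⊎ ∃[ j ] (¬ Covers E (_∈ [ i ]) × ¬ Covers E (_∈ [ j ]) × Covers E (_∈ i ∷ j ∷ []))

SmallOrBipartite : (k : ℕ) → (Fin k → Fin k → Set) → Set
SmallOrBipartite k E = k ≤ 3 ⊎ (k ≤ 4 × ∃ (IsTwoColouring E))

All≢⇒Disjoint : ∀ {xs ys : List A} → All (λ y → All (y ≢_) xs) ys → Disjoint xs ys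
All≢⇒Disjoint ys≢xs (v∈xs , v∈ys) = All¬⇒¬Any (All.lookup ys≢xs v∈ys) v∈xs

pair-pigeonhole : ∀ {x y b c e : A} → b ≢ c → b ≢ e → c ≢ e →
                  b ∈ x ∷ y ∷ [] → c ∈ x ∷ y ∷ [] → ¬ e ∈ x ∷ y ∷ []
pair-pigeonhole b≢c _   _   (here refl)         (here refl)         _                   = b≢c refl
pair-pigeonhole b≢c _   _   (there (here refl)) (there (here refl)) _                   = b≢c refl
pair-pigeonhole _   b≢e _   (here refl)         _                   (here refl)         = b≢e refl
pair-pigeonhole _   b≢e _   (there (here refl)) _                   (there (here refl)) = b≢e refl
pair-pigeonhole _   _   c≢e _                   (here refl)         (here refl)         = c≢e refl
pair-pigeonhole _   _   c≢e _                   (there (here refl)) (there (here refl)) = c≢e refl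

module _ {k : ℕ} where
  open import Data.List.Membership.DecPropositional (_≟_ {k}) using (_∈?_)

  enumeration-length : (xs : List (Fin k)) → (∀ x → x ∈ xs) → k ≤ length xs
  enumeration-length xs xs∋ = injective⇒≤ {f = Any.index ∘ xs∋} λ {x} {y} ix≡iy → begin
    x                              ≡⟨ lookup-index (xs∋ x) ⟩
    lookup xs (Any.index (xs∋ x))  ≡⟨ cong (lookup xs) ix≡iy ⟩
    lookup xs (Any.index (xs∋ y))  ≡⟨ sym (lookup-index (xs∋ y)) ⟩
    y                              ∎
    where open ≡-Reasoning

  ≤length⊎fresh : (xs : List (Fin k)) → k ≤ length xs ⊎ ∃ λ x → All (x ≢_) xs
  ≤length⊎fresh xs with any? (λ x → all? (λ y → ¬? (x ≟ y)) xs)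
  ... | yes found = inj₂ found
  ... | no  none  = inj₁ (enumeration-length xs λ x →
                      decidable-stable (x ∈? xs) λ x∉xs → none (x , ¬Any⇒All¬ xs x∉xs))

  module _ {E : Fin k → Fin k → Set} where

    shared-member-covers : ∀ {a b c e} → b ≢ c → b ≢ e → c ≢ e →
                           Covers E (_∈ a ∷ b ∷ []) → Covers E (_∈ a ∷ c ∷ []) → Covers E (_∈ a ∷ e ∷ []) →
                           Covers E (_∈ [ a ])
    shared-member-covers {a} b≢c b≢e c≢e ab ac ae {x} {y} xy with x ≟ a | y ≟ a
    ... | yes x≡a | _       = inj₁ (here x≡a)
    ... | no  _   | yes y≡a = inj₂ (here y≡a)
    ... | no  x≢a | no  y≢a =
      ⊥-elim (pair-pigeonhole b≢c b≢e c≢e (endpoint ab) (endpoint ac) (endpoint ae))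
      where
        endpoint : ∀ {d} → Covers E (_∈ a ∷ d ∷ []) → d ∈ x ∷ y ∷ []
        endpoint cover with cover xy
        ... | inj₁ (here x≡a)         = contradiction x≡a x≢a
        ... | inj₁ (there (here x≡d)) = here (sym x≡d)
        ... | inj₂ (here y≡a)         = contradiction y≡a y≢a
        ... | inj₂ (there (here y≡d)) = there (here (sym y≡d))

    disjoint-covers-colouring : ∀ {xs ys} → Covers E (_∈ xs) → Covers E (_∈ ys) → Disjoint xs ys →
                                ∃ (IsTwoColouring E)
    disjoint-covers-colouring {xs} cover-xs cover-ys xs#ys = (λ x → does (x ∈? xs)) , proper
      where
        proper : IsTwoColouring E (λ x → does (x ∈? xs))
        proper x y xy with x ∈? xs | y ∈? xs
        ... | yes _    | no _     = λ ()
        ... | no _     | yes _    = λ ()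
        ... | no x∉xs  | no y∉xs  with cover-xs xy
        ...   | inj₁ x∈xs = contradiction x∈xs x∉xs
        ...   | inj₂ y∈xs = contradiction y∈xs y∉xs
        proper x y xy | yes x∈xs | yes y∈xs with cover-ys xy
        ...   | inj₁ x∈ys = contradiction (x∈xs , x∈ys) xs#ys
        ...   | inj₂ y∈ys = contradiction (y∈xs , y∈ys) xs#ys

    module _ (total : ∀ x → ∃ (E x)) where

      disjoint-covers-enumerate : ∀ {xs ys} → Covers E (_∈ xs) → Covers E (_∈ ys) → Disjoint xs ys →
                                  ∀ x → x ∈ xs ++ ys
      disjoint-covers-enumerate {xs} cover-xs cover-ys xs#ys x with x ∈? xs | total x
      ... | yes x∈xs | _      = ∈-++⁺ˡ x∈xs
      ... | no  x∉xs | y , xy with cover-xs xy | cover-ys xy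
      ...   | inj₁ x∈xs | _         = contradiction x∈xs x∉xs
      ...   | inj₂ _    | inj₁ x∈ys = ∈-++⁺ʳ xs x∈ys
      ...   | inj₂ y∈xs | inj₂ y∈ys = contradiction (y∈xs , y∈ys) xs#ys

      disjoint-covers⇒≤ : ∀ {xs ys} → Covers E (_∈ xs) → Covers E (_∈ ys) →
                          All (λ y → All (y ≢_) xs) ys → k ≤ length (xs ++ ys)
      disjoint-covers⇒≤ cover-xs cover-ys ys≢xs =
        enumeration-length _ (disjoint-covers-enumerate cover-xs cover-ys (All≢⇒Disjoint ys≢xs))

      disjoint-pair-covers : ∀ {a b c d} → Covers E (_∈ a ∷ b ∷ []) → Covers E (_∈ c ∷ d ∷ []) →
                             All (λ y → All (y ≢_) (a ∷ b ∷ [])) (c ∷ d ∷ []) → SmallOrBipartite k E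
      disjoint-pair-covers ab cd cd≢ab =
        inj₂ (disjoint-covers⇒≤ ab cd cd≢ab , disjoint-covers-colouring ab cd (All≢⇒Disjoint cd≢ab))

      module _ (partnered : ∀ i → Partnered E i) where

        covers-singleton⇒≤3 : ∀ {a} → Covers E (_∈ [ a ]) → k ≤ 3
        covers-singleton⇒≤3 {a} a-covers with ≤length⊎fresh [ a ]
        ... | inj₁ k≤1 = ≤-trans k≤1 (s≤s z≤n)
        ... | inj₂ (j , j≢a ∷ []) with partnered j
        ...   | inj₁ j-covers = ≤-trans (disjoint-covers⇒≤ a-covers j-covers ((j≢a ∷ []) ∷ [])) (n≤1+n 2)
        ...   | inj₂ (j′ , _ , ¬j′ , jj′) with j′ ≟ a
        ...     | yes refl = ⊥-elim (¬j′ a-covers)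
        ...     | no  j′≢a = disjoint-covers⇒≤ a-covers jj′ ((j≢a ∷ []) ∷ (j′≢a ∷ []) ∷ [])

        -- A further class e cannot be partnered with a, otherwise {a} would cover by
        -- shared-member-covers; so its pair is disjoint from {a, b} or from {a, c}.
        overlapping-pair-covers : ∀ {a b c} → ¬ Covers E (_∈ [ a ]) →
                                  Covers E (_∈ a ∷ b ∷ []) → Covers E (_∈ a ∷ c ∷ []) → c ≢ b →
                                  SmallOrBipartite k E
        overlapping-pair-covers {a} {b} {c} ¬a ab ac c≢b with ≤length⊎fresh (a ∷ b ∷ c ∷ [])
        ... | inj₁ k≤3 = inj₁ k≤3
        ... | inj₂ (e , e≢a ∷ e≢b ∷ e≢c ∷ []) with partnered e
        ...   | inj₁ e-covers = inj₁ (covers-singleton⇒≤3 e-covers)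
        ...   | inj₂ (f , _ , _ , ef) with f ≟ a | f ≟ b
        ...     | yes refl | _        =
          ⊥-elim (¬a (shared-member-covers (c≢b ∘ sym) (e≢b ∘ sym) (e≢c ∘ sym) ab ac (covers-swap ef)))
        ...     | no  _    | yes refl =
          disjoint-pair-covers ac ef ((e≢a ∷ e≢c ∷ []) ∷ (partner-≢ ¬a ab ∷ (c≢b ∘ sym) ∷ []) ∷ [])
        ...     | no  f≢a  | no  f≢b  =
          disjoint-pair-covers ab ef ((e≢a ∷ e≢b ∷ []) ∷ (f≢a ∷ f≢b ∷ []) ∷ [])

        small-or-bipartite : Fin k → SmallOrBipartite k E
        small-or-bipartite a with partnered a
        ... | inj₁ a-covers = inj₁ (covers-singleton⇒≤3 a-covers)
        ... | inj₂ (b , ¬a , ¬b , ab) with ≤length⊎fresh (a ∷ b ∷ [])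
        ...   | inj₁ k≤2 = inj₁ (≤-trans k≤2 (n≤1+n 2))
        ...   | inj₂ (c , c≢a ∷ c≢b ∷ []) with partnered c
        ...     | inj₁ c-covers = inj₁ (covers-singleton⇒≤3 c-covers)
        ...     | inj₂ (d , _ , _ , cd) with d ≟ a | d ≟ b
        ...       | yes refl | _        =
          overlapping-pair-covers ¬a ab (covers-swap cd) c≢b
        ...       | no  _    | yes refl =
          overlapping-pair-covers ¬b (covers-swap ab) (covers-swap cd) c≢a
        ...       | no  d≢a  | no  d≢b  =
          disjoint-pair-covers ab cd ((c≢a ∷ c≢b ∷ []) ∷ (d≢a ∷ d≢b ∷ []) ∷ [])

module _ (G : Graph n) (cubic : Cubic G) where

  threeDom-part⇔ : ∀ {cls : Fin n → Fin k} {i} →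
                   ThreeDom G (part cls i) ⇔ Covers (Quotient G cls) (_∈ [ i ])
  threeDom-part⇔ {cls = cls} =
    ⇔.trans (threeDom⇔covers G cubic λ _ → part-∈ cls) (⇔.sym (covers-quotient⇔ G cls))

  threeDom-part∪⇔ : ∀ {cls : Fin n → Fin k} {i j} →
                    ThreeDom G (part cls i ∪ part cls j) ⇔ Covers (Quotient G cls) (_∈ i ∷ j ∷ [])
  threeDom-part∪⇔ {cls = cls} =
    ⇔.trans (threeDom⇔covers G cubic λ _ → part∪-∈ cls) (⇔.sym (covers-quotient⇔ G cls))

  quotient-partnered : ∀ {cls : Fin n → Fin k} → IsThreeCoalitionPartition G k cls →
                       ∀ i → Partnered (Quotient G cls) i
  quotient-partnered (_ , coalition) i with coalition i
  ... | inj₁ (dom , _)              = inj₁ (to threeDom-part⇔ dom)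
  ... | inj₂ (j , _ , ¬i , ¬j , ij) =
    inj₂ (j , ¬i ∘ from threeDom-part⇔ , ¬j ∘ from threeDom-part⇔ , to threeDom-part∪⇔ ij)

  quotient-total : ∀ {cls : Fin n → Fin k} → (∀ i → ∃[ v ] cls v ≡ i) → ∀ X → ∃ (Quotient G cls X)
  quotient-total {cls = cls} surjective X with surjective X
  ... | v , refl with card-pos⇒∃ (subst (0 <_) (sym (cubic v)) (s≤s z≤n))
  ...   | u , vu = cls u , v , u , vu , refl , refl

  coalition-partition-bound : HasThreeCoalitionPartition G k → k ≤ 3 ⊎ (k ≤ 4 × Bipartite G)
  coalition-partition-bound {zero}  _                               = inj₁ z≤n
  coalition-partition-bound {suc _} (cls , partition@(surjective , _)) =
    Sum.map₂ (Product.map₂ (quotient-colouring⇒bipartite G cls))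
      (small-or-bipartite (quotient-total surjective) (quotient-partnered partition) zero)

  partition-from-partners : (cls : Fin n → Fin k) → (∀ i → ∃[ v ] cls v ≡ i) →
                            (p : Fin k → Fin k) → (∀ i → p i ≢ i) →
                            (∀ i → ∃₂ λ u v → Adj G u v × cls u ≢ i × cls v ≢ i) →
                            (∀ i → Covers (Adj G) (λ v → cls v ∈ i ∷ p i ∷ [])) →
                            HasThreeCoalitionPartition G k
  partition-from-partners cls surjective p p≢id missing covers =
    cls , surjective , λ i → inj₂ (p i , p≢id i , ¬dom i , ¬dom (p i) , dom i)
    where
      ¬dom : ∀ i → ¬ ThreeDom G (part cls i)
      ¬dom i with missing i
      ... | u , v , uv , cu≢i , cv≢i =
        edge-outside⇒¬threeDom G (≤-reflexive ∘ cubic) uv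
          (dec-false (cls u ≟ i) cu≢i) (dec-false (cls v ≟ i) cv≢i)

      dom : ∀ i → ThreeDom G (part cls i ∪ part cls (p i))
      dom i = from (threeDom⇔covers G cubic λ _ → part∪-∈ cls) (covers i)

-- Partitions with three and four classes

isolating : Fin n → Fin n → (Fin n → Fin k) → Fin n → Fin (2 + k)
isolating v u f w with w ≟ v | w ≟ u
... | yes _ | _     = zero
... | no  _ | yes _ = suc zero
... | no  _ | no  _ = 2 ↑ʳ f w

module Isolating (v u : Fin n) (f : Fin n → Fin k) where

  isolating-first : isolating v u f v ≡ zero
  isolating-first with v ≟ v
  ... | yes _   = refl
  ... | no  v≢v = contradiction refl v≢v

  isolating-second : u ≢ v → isolating v u f u ≡ suc zero
  isolating-second u≢v with u ≟ v | u ≟ u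
  ... | yes u≡v | _       = contradiction u≡v u≢v
  ... | no  _   | yes _   = refl
  ... | no  _   | no  u≢u = contradiction refl u≢u

  isolating-view : ∀ w → w ≡ v ⊎ w ≡ u ⊎ isolating v u f w ≡ 2 ↑ʳ f w
  isolating-view w with w ≟ v | w ≟ u
  ... | yes w≡v | _       = inj₁ w≡v
  ... | no  _   | yes w≡u = inj₂ (inj₁ w≡u)
  ... | no  _   | no  _   = inj₂ (inj₂ refl)

  isolating-rest : ∀ {w} → w ≢ v → w ≢ u → isolating v u f w ≡ 2 ↑ʳ f w
  isolating-rest {w} w≢v w≢u with w ≟ v | w ≟ u
  ... | yes w≡v | _       = contradiction w≡v w≢v
  ... | no  _   | yes w≡u = contradiction w≡u w≢u
  ... | no  _   | no  _   = refl

record NonBacktrackingWalk₃ (G : Graph n) : Set where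
  field
    y v u x : Fin n
    vy : Adj G v y
    vu : Adj G v u
    ux : Adj G u x
    y≢u : y ≢ u
    x≢v : x ≢ v

non-backtracking-walk : (G : Graph n) → (∀ v → 1 < degree G v) → Fin n → NonBacktrackingWalk₃ G
non-backtracking-walk G δ>1 v =
  let u , _ , vu = ∃-neighbour-≢ G (δ>1 v) v
      x , x≢v , ux = ∃-neighbour-≢ G (δ>1 u) v
      y , y≢u , vy = ∃-neighbour-≢ G (δ>1 v) u
  in record { vy = vy ; vu = vu ; ux = ux ; y≢u = y≢u ; x≢v = x≢v }

module _ {G : Graph n} (cubic : Cubic G) (walk : NonBacktrackingWalk₃ G) where
  open NonBacktrackingWalk₃ walk

  private
    u≢v : u ≢ v
    u≢v = adj⇒≢ G vu ∘ sym

    x≢u : x ≢ u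
    x≢u = adj⇒≢ G ux ∘ sym

    y≢v : y ≢ v
    y≢v = adj⇒≢ G vy ∘ sym

  -- The union of the rest with {v} or with {u} is the complement of a single vertex.
  three-partition : HasThreeCoalitionPartition G 3
  three-partition =
    partition-from-partners G cubic cls surjective partner partner≢id missing covers
    where
      cls : Fin n → Fin 3
      cls = isolating v u λ _ → zero

      open Isolating v u (λ _ → zero)

      cls-v : cls v ≡ zero
      cls-v = isolating-first

      cls-u : cls u ≡ suc zero
      cls-u = isolating-second u≢v

      partner : Fin 3 → Fin 3
      partner zero             = suc (suc zero)
      partner (suc zero)       = suc (suc zero)
      partner (suc (suc zero)) = zero

      partner≢id : ∀ i → partner i ≢ i
      partner≢id zero             ()
      partner≢id (suc zero)       ()
      partner≢id (suc (suc zero)) ()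

      cls-x : cls x ≡ suc (suc zero)
      cls-x = isolating-rest x≢v x≢u

      cls-y : cls y ≡ suc (suc zero)
      cls-y = isolating-rest y≢v y≢u

      surjective : ∀ i → ∃[ w ] cls w ≡ i
      surjective zero             = v , cls-v
      surjective (suc zero)       = u , cls-u
      surjective (suc (suc zero)) = x , cls-x

      missing : ∀ i → ∃₂ λ a b → Adj G a b × cls a ≢ i × cls b ≢ i
      missing zero             = u , x , ux , ≡-≢-trans cls-u (λ ()) , ≡-≢-trans cls-x (λ ())
      missing (suc zero)       = v , y , vy , ≡-≢-trans cls-v (λ ()) , ≡-≢-trans cls-y (λ ())
      missing (suc (suc zero)) = v , u , vu , ≡-≢-trans cls-v (λ ()) , ≡-≢-trans cls-u (λ ())

      away-from-u : ∀ {w} → w ≢ u → cls w ∈ zero ∷ suc (suc zero) ∷ []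
      away-from-u {w} w≢u with isolating-view w
      ... | inj₁ refl        = here cls-v
      ... | inj₂ (inj₁ w≡u)  = contradiction w≡u w≢u
      ... | inj₂ (inj₂ cls-w) = there (here cls-w)

      away-from-v : ∀ {w} → w ≢ v → cls w ∈ suc zero ∷ suc (suc zero) ∷ []
      away-from-v {w} w≢v with isolating-view w
      ... | inj₁ w≡v         = contradiction w≡v w≢v
      ... | inj₂ (inj₁ refl) = here (cls-u)
      ... | inj₂ (inj₂ cls-w) = there (here cls-w)

      covers : ∀ i → Covers (Adj G) (λ w → cls w ∈ i ∷ partner i ∷ [])
      covers zero             = covers-mono (λ {w} → away-from-u {w}) (covers-≢ G u)
      covers (suc zero)       = covers-mono (λ {w} → away-from-v {w}) (covers-≢ G v)
      covers (suc (suc zero)) = covers-mono (λ {w} → ∈-pair-swap ∘ away-from-u {w}) (covers-≢ G u)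

  -- Classes {v}, {u}, and the rest of the colour classes of v and of u; partners together
  -- make up a colour class.
  four-partition : ∀ {c} → IsTwoColouring (Adj G) c → HasThreeCoalitionPartition G 4
  four-partition {c} proper =
    partition-from-partners G cubic cls surjective partner partner≢id missing covers
    where
      side : Fin n → Fin 2
      side w = if does (c w ≟ᵇ c v) then zero else suc zero

      cls : Fin n → Fin 4
      cls = isolating v u side

      open Isolating v u side

      cls-v : cls v ≡ zero
      cls-v = isolating-first

      cls-u : cls u ≡ suc zero
      cls-u = isolating-second u≢v

      partner : Fin 4 → Fin 4
      partner zero                   = suc (suc zero)
      partner (suc zero)             = suc (suc (suc zero))
      partner (suc (suc zero))       = zero
      partner (suc (suc (suc zero))) = suc zero

      partner≢id : ∀ i → partner i ≢ i
      partner≢id zero                   ()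
      partner≢id (suc zero)             ()
      partner≢id (suc (suc zero))       ()
      partner≢id (suc (suc (suc zero))) ()

      side-of-v : ∀ w → c w ≡ c v → side w ≡ zero
      side-of-v w cw≡cv = cong (λ b → if b then zero else suc zero) (dec-true (c w ≟ᵇ c v) cw≡cv)

      side-of-u : ∀ w → c w ≢ c v → side w ≡ suc zero
      side-of-u w cw≢cv = cong (λ b → if b then zero else suc zero) (dec-false (c w ≟ᵇ c v) cw≢cv)

      v-side : ∀ {w} → c w ≡ c v → cls w ∈ zero ∷ suc (suc zero) ∷ []
      v-side {w} cw≡cv with isolating-view w
      ... | inj₁ refl         = here cls-v
      ... | inj₂ (inj₁ refl)  = contradiction (sym cw≡cv) (proper v u vu)
      ... | inj₂ (inj₂ cls-w) = there (here (trans cls-w (cong (2 ↑ʳ_) (side-of-v w cw≡cv))))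

      u-side : ∀ {w} → c w ≢ c v → cls w ∈ suc zero ∷ suc (suc (suc zero)) ∷ []
      u-side {w} cw≢cv with isolating-view w
      ... | inj₁ refl         = contradiction refl cw≢cv
      ... | inj₂ (inj₁ refl)  = here (cls-u)
      ... | inj₂ (inj₂ cls-w) = there (here (trans cls-w (cong (2 ↑ʳ_) (side-of-u w cw≢cv))))

      cx≡cv : c x ≡ c v
      cx≡cv with colour-class-covers proper (c v) ux
      ... | inj₁ cu≡cv = contradiction (sym cu≡cv) (proper v u vu)
      ... | inj₂ cx≡cv = cx≡cv

      cls-x : cls x ≡ suc (suc zero)
      cls-x = trans (isolating-rest x≢v x≢u) (cong (2 ↑ʳ_) (side-of-v x cx≡cv))

      cls-y : cls y ≡ suc (suc (suc zero))
      cls-y = trans (isolating-rest y≢v y≢u) (cong (2 ↑ʳ_) (side-of-u y (proper v y vy ∘ sym)))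

      surjective : ∀ i → ∃[ w ] cls w ≡ i
      surjective zero                   = v , cls-v
      surjective (suc zero)             = u , cls-u
      surjective (suc (suc zero))       = x , cls-x
      surjective (suc (suc (suc zero))) = y , cls-y

      missing : ∀ i → ∃₂ λ a b → Adj G a b × cls a ≢ i × cls b ≢ i
      missing zero             = u , x , ux , ≡-≢-trans cls-u (λ ()) , ≡-≢-trans cls-x (λ ())
      missing (suc zero)       = v , y , vy , ≡-≢-trans cls-v (λ ()) , ≡-≢-trans cls-y (λ ())
      missing (suc (suc _))    = v , u , vu , ≡-≢-trans cls-v (λ ()) , ≡-≢-trans cls-u (λ ())

      covers : ∀ i → Covers (Adj G) (λ w → cls w ∈ i ∷ partner i ∷ [])
      covers zero =
        covers-mono (λ {w} → v-side {w}) (colour-class-covers proper (c v))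
      covers (suc zero) =
        covers-mono (λ {w} → u-side {w}) (colour-coclass-covers proper (c v))
      covers (suc (suc zero)) =
        covers-mono (λ {w} → ∈-pair-swap ∘ v-side {w}) (colour-class-covers proper (c v))
      covers (suc (suc (suc zero))) =
        covers-mono (λ {w} → ∈-pair-swap ∘ u-side {w}) (colour-coclass-covers proper (c v))

theorem4p2 : ∀ (n : ℕ) (G : Graph n) → 0 < n → Cubic G →
    (Bipartite G → C₃≡ G 4) × (¬ Bipartite G → C₃≡ G 3)
theorem4p2 n G 0<n cubic = bipartite-case , non-bipartite-case
  where
    walk : NonBacktrackingWalk₃ G
    walk = non-backtracking-walk G (λ v → subst (1 <_) (sym (cubic v)) (s≤s (s≤s z≤n))) (fromℕ< 0<n)

    bipartite-case : Bipartite G → C₃≡ G 4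
    bipartite-case (_ , proper) = four-partition cubic walk proper , λ _ partition →
      Sum.[ (λ k≤3 → ≤-trans k≤3 (n≤1+n 3)) , proj₁ ] (coalition-partition-bound G cubic partition)

    non-bipartite-case : ¬ Bipartite G → C₃≡ G 3
    non-bipartite-case ¬bipartite = three-partition cubic walk , λ _ partition →
      Sum.[ id , (λ (_ , bipartite) → contradiction bipartite ¬bipartite) ]
        (coalition-partition-bound G cubic partition)
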